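{- Let $a \geq 1$ and let $d$ be a positive integer with $1 \le a \le d+2$ and $\lceil d/a \rceil \geq 12$. If $d \not\equiv -3 \pmod a$, then for all integers $n$ with $1 \leq n \leq d+3a$, \[ \Delta_d^{(a,-)}(n) := q_d^{(a)}(n) - Q_d^{(a,-)}(n) \geq 0. \] If $d \equiv -3 \pmod a$, then $\Delta_d^{(a,-)}(n) \geq 0$ for all integers $n$ with $1 \leq n \leq d+3a$ except $n = d+3+a$.
   Context: $q_d^{(a)}(n)$ denotes the number of partitions of $n$ in which every part is at least $a$ and any two parts differ by at least $d$. $Q_d^{(a,-)}(n)$ denotes the number of partitions of $n$ into parts congruent to $a$ or $-a$ modulo $d+3$, where the part equal to $d+3-a$ is not allowed. -}

module Defs where

open import Data.Nat using (ℕ; zero; suc; _+_; _*_; _∸_; _≤_; _<_; _≤?_; _≟_; NonZero)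
open import Data.Nat.DivMod using (_/_; _%_)
open import Data.List using (List; []; _∷_; length; filter; concatMap; map; upTo)
open import Data.Product using (_×_)
open import Data.Sum using (_⊎_)
open import Data.Unit using (⊤)
open import Relation.Nullary using (¬_; Dec; yes; no)
open import Relation.Nullary.Decidable using (_×-dec_; _⊎-dec_; ¬?)
open import Relation.Unary using (Pred; Decidable)
open import Relation.Binary.PropositionalEquality using (_≡_)
open import Data.List.Relation.Unary.All using (All; all?)
open import Level using (0ℓ)

⌈_/_⌉ : ℕ → (n : ℕ) → .{{NonZero n}} → ℕ
⌈ m / n ⌉ = (m + n ∸ 1) / n

-- A partition is represented as a weakly decreasing list of positive parts.
-- partsBounded f n m : all partitions of n with every part ≤ m
-- (f is fuel; f = n suffices since each part is ≥ 1).
partsBounded : ℕ → ℕ → ℕ → List (List ℕ)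
partsBounded _       zero    _ = [] ∷ []
partsBounded zero    (suc _) _ = []
partsBounded (suc f) (suc n) m =
  concatMap (λ k → map (suc k ∷_) (partsBounded f (suc n ∸ suc k) (suc k)))
            (filter (λ k → suc k ≤? m) (upTo (suc n)))

partitions : ℕ → List (List ℕ)
partitions n = partsBounded n n n

GapAtLeast : ℕ → List ℕ → Set
GapAtLeast d []           = ⊤
GapAtLeast d (x ∷ [])     = ⊤
GapAtLeast d (x ∷ y ∷ xs) = (y + d ≤ x) × GapAtLeast d (y ∷ xs)

gapAtLeast? : (d : ℕ) → Decidable (GapAtLeast d)
gapAtLeast? d []           = yes _
gapAtLeast? d (x ∷ [])     = yes _
gapAtLeast? d (x ∷ y ∷ xs) = (y + d ≤? x) ×-dec gapAtLeast? d (y ∷ xs)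

IsQDist : ℕ → ℕ → List ℕ → Set
IsQDist a d λs = All (a ≤_) λs × GapAtLeast d λs

isQDist? : (a d : ℕ) → Decidable (IsQDist a d)
isQDist? a d λs = all? (a ≤?_) λs ×-dec gapAtLeast? d λs

q : ℕ → ℕ → ℕ → ℕ
q d a n = length (filter (isQDist? a d) (partitions n))

AllowedPart : ℕ → ℕ → ℕ → Set
AllowedPart d a p =
  ((p % (3 + d) ≡ a % (3 + d)) ⊎ (p % (3 + d) ≡ (3 + d ∸ a) % (3 + d)))
  × ¬ (p ≡ 3 + d ∸ a)

allowedPart? : (d a : ℕ) → Decidable (AllowedPart d a)
allowedPart? d a p =
  ((p % (3 + d) ≟ a % (3 + d)) ⊎-dec (p % (3 + d) ≟ (3 + d ∸ a) % (3 + d)))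
  ×-dec ¬? (p ≟ 3 + d ∸ a)

Q⁻ : ℕ → ℕ → ℕ → ℕ
Q⁻ d a n = length (filter (λ λs → all? (allowedPart? d a) λs) (partitions n))

module Submission where

-- The bound ⌈d/a⌉ ≥ 12 gives 4a ≤ d, and then every part allowed in Q_d^{(a,-)}(n)
-- with n ≤ d + 3a is either a or b = d + 3 + a (the next candidates 2(d+3) ∓ a are
-- too large); since 2b > d + 3a, such a partition is a^k or b a^k.  Hence there is at
-- most one partition of each shape, and both shapes occur only if a ∣ d + 3.  On the
-- other side, q_d^{(a)}(n) counts (n) once n ≥ a, and also (n − a, a) once n ≥ b + a;
-- a mixed pair with n < b + a forces n = b.

open import Defs
open import Data.Nat using (ℕ; zero; suc; _+_; _*_; _∸_; _≤_; _≥_; _<_; _≤?_; z≤n; s≤s; NonZero; >-nonZero⁻¹)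
open import Data.Nat.Properties
open import Data.Nat.DivMod using (_/_; _%_; m/n*n≤m; m<n⇒m%n≡m; m≡m%n+[m/n]*n)
open import Data.Nat.Divisibility using (_∣_; divides; ∣m+n∣m⇒∣n)
open import Data.Nat.ListAction using (sum)
open import Data.Nat.Tactic.RingSolver using (solve-∀)
open import Data.List using (List; []; _∷_; [_]; length; filter; map; upTo)
open import Data.List.Properties using (∷-injective)
open import Data.List.Membership.Propositional using (_∈_; find; lose)
open import Data.List.Membership.Propositional.Properties
open import Data.List.Relation.Unary.Any using (here; there)
open import Data.List.Relation.Unary.All as All using (All; []; _∷_; all?)
import Data.List.Relation.Unary.All.Properties as All
open import Data.List.Relation.Unary.AllPairs as AllPairs using (AllPairs; []; _∷_)
import Data.List.Relation.Unary.AllPairs.Properties as AllPairs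
open import Data.List.Relation.Unary.Unique.Propositional using (Unique)
import Data.List.Relation.Unary.Unique.Propositional.Properties as Unique
open import Data.List.Relation.Binary.Disjoint.Propositional using (Disjoint)
open import Data.Product using (_×_; _,_; ∃; proj₁; proj₂)
open import Data.Sum as Sum using (_⊎_; inj₁; inj₂)
open import Function using (_∘_)
open import Relation.Nullary using (¬_; contradiction)
open import Relation.Unary using (Decidable)
open import Relation.Binary.PropositionalEquality using (_≡_; _≢_; refl; sym; trans; cong; subst; subst₂)

private
  branch : ℕ → ℕ → ℕ → List (List ℕ)
  branch f n k = map (suc k ∷_) (partsBounded f (n ∸ k) (suc k))

  bounded? : (m : ℕ) → Decidable (λ k → suc k ≤ m)
  bounded? m k = suc k ≤? m

partsBounded-sound : ∀ f n m {xs} → xs ∈ partsBounded f n m →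
                     sum xs ≡ n × All (_≤ m) xs × AllPairs _≥_ xs
partsBounded-sound f       zero    m (here refl) = refl , [] , []
partsBounded-sound (suc f) (suc n) m xs∈
  with k , k∈ , xs∈k ← find (∈-concatMap⁻ (branch f n) {xs = filter (bounded? m) (upTo (suc n))} xs∈)
  with k∈upTo , k<m ← ∈-filter⁻ (bounded? m) {xs = upTo (suc n)} k∈
  with ys , ys∈ , refl ← ∈-map⁻ (suc k ∷_) xs∈k
  with Σys , ys≤k , ys↓ ← partsBounded-sound f (n ∸ k) (suc k) ys∈ =
  cong suc (trans (cong (k +_) Σys) (m+[n∸m]≡n (≤-pred (∈-upTo⁻ k∈upTo)))) ,
  k<m ∷ All.map (λ y≤k → ≤-trans y≤k k<m) ys≤k ,
  ys≤k ∷ ys↓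

∷-∈-partsBounded : ∀ {f n m k ys} → k ≤ n → suc k ≤ m → ys ∈ partsBounded f (n ∸ k) (suc k) →
                   (suc k ∷ ys) ∈ partsBounded (suc f) (suc n) m
∷-∈-partsBounded {f} {n} {m} {k} {ys} k≤n k<m ys∈ =
  ∈-concatMap⁺ (branch f n) (lose {P = λ k′ → suc k ∷ ys ∈ branch f n k′}
    (∈-filter⁺ (bounded? m) (∈-upTo⁺ (s≤s k≤n)) k<m) (∈-map⁺ (suc k ∷_) ys∈))

[]∈partsBounded : ∀ f n m → [] ∈ partsBounded f (n ∸ n) m
[]∈partsBounded f n m rewrite n∸n≡0 n = here refl

singleton∈partsBounded : ∀ {f m} n → suc n ≤ m → [ suc n ] ∈ partsBounded (suc f) (suc n) m
singleton∈partsBounded {f} {m} n n<m = ∷-∈-partsBounded ≤-refl n<m ([]∈partsBounded f n (suc n))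

singleton∈partitions : ∀ {n} → 1 ≤ n → [ n ] ∈ partitions n
singleton∈partitions {suc n} _ = singleton∈partsBounded n ≤-refl

pair∈partitions : ∀ {u v} → 1 ≤ v → v ≤ u → (u ∷ v ∷ []) ∈ partitions (u + v)
pair∈partitions {suc k} {suc j} _ (s≤s j≤k) =
  ∷-∈-partsBounded k≤k+1+j (s≤s k≤k+1+j) (subst₂ (λ f r → [ suc j ] ∈ partsBounded f r (suc k))
    (sym (+-suc k j)) (sym (m+n∸m≡n k (suc j))) (singleton∈partsBounded j (s≤s j≤k)))
  where k≤k+1+j = m≤m+n k (suc j)

map-∷-disjoint : ∀ {A : Set} {x y : A} {xss yss} → x ≢ y → Disjoint (map (x ∷_) xss) (map (y ∷_) yss)
map-∷-disjoint x≢y (v∈xss , v∈yss)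
  with _ , _ , refl ← ∈-map⁻ _ v∈xss
  with _ , _ , eq ← ∈-map⁻ _ v∈yss = x≢y (proj₁ (∷-injective eq))

partsBounded-unique : ∀ f n m → Unique (partsBounded f n m)
partsBounded-unique f       zero    m = [] ∷ []
partsBounded-unique zero    (suc n) m = []
partsBounded-unique (suc f) (suc n) m =
  Unique.concat⁺
    (All.map⁺ (All.tabulate λ {k} _ →
      Unique.map⁺ (λ eq → proj₂ (∷-injective eq)) (partsBounded-unique f (n ∸ k) (suc k))))
    (AllPairs.map⁺ (AllPairs.map (λ k≢k′ {_} → map-∷-disjoint (k≢k′ ∘ suc-injective))
      (Unique.filter⁺ (bounded? m) (Unique.upTo⁺ (suc n)))))

parts≤sum : ∀ xs → All (_≤ sum xs) xs
parts≤sum []       = []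
parts≤sum (x ∷ xs) = m≤m+n x (sum xs) ∷ All.map (λ y≤ → ≤-trans y≤ (m≤n+m (sum xs) x)) (parts≤sum xs)

distinct-∈⇒2≤length : ∀ {A : Set} {x y : A} {xs} → x ∈ xs → y ∈ xs → x ≢ y → 2 ≤ length xs
distinct-∈⇒2≤length (here refl)   (here refl)   x≢y = contradiction refl x≢y
distinct-∈⇒2≤length (here refl)   (there y∈)    _   = s≤s (∈-length y∈)
distinct-∈⇒2≤length (there x∈)    (here refl)   _   = s≤s (∈-length x∈)
distinct-∈⇒2≤length (there x∈)    (there y∈)    x≢y = m≤n⇒m≤1+n (distinct-∈⇒2≤length x∈ y∈ x≢y)

module _ {A : Set} {P R : A → Set}
         (P-unique : ∀ {x y} → P x → P y → x ≡ y) (R-unique : ∀ {x y} → R x → R y → x ≡ y) where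

  distinct⇒different-classes : ∀ {x y} → P x ⊎ R x → P y ⊎ R y → x ≢ y → (P x × R y) ⊎ (R x × P y)
  distinct⇒different-classes (inj₁ px) (inj₁ py) x≢y = contradiction (P-unique px py) x≢y
  distinct⇒different-classes (inj₁ px) (inj₂ ry) _   = inj₁ (px , ry)
  distinct⇒different-classes (inj₂ rx) (inj₁ py) _   = inj₂ (rx , py)
  distinct⇒different-classes (inj₂ rx) (inj₂ ry) x≢y = contradiction (R-unique rx ry) x≢y

  length≤-of-two-classes :
    ∀ {k} xs → Unique xs → (∀ {x} → x ∈ xs → P x ⊎ R x) →
    (∀ {x} → x ∈ xs → 1 ≤ k) → (∀ {x y} → x ∈ xs → y ∈ xs → P x → R y → 2 ≤ k) →
    length xs ≤ k
  length≤-of-two-classes [] _ _ _ _ = z≤n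
  length≤-of-two-classes (x ∷ []) _ _ nonempty _ = nonempty (here refl)
  length≤-of-two-classes (x ∷ y ∷ []) ((x≢y ∷ _) ∷ _) class _ mixed
    with distinct⇒different-classes (class (here refl)) (class (there (here refl))) x≢y
  ... | inj₁ (px , ry) = mixed (here refl) (there (here refl)) px ry
  ... | inj₂ (rx , py) = mixed (there (here refl)) (here refl) py rx
  length≤-of-two-classes (x ∷ y ∷ z ∷ _) ((x≢y ∷ x≢z ∷ _) ∷ (y≢z ∷ _) ∷ _) class _ _
    with distinct⇒different-classes (class (here refl)) (class (there (here refl))) x≢y
       | class (there (there (here refl)))
  ... | inj₁ (px , _) | inj₁ pz = contradiction (P-unique px pz) x≢z
  ... | inj₁ (_ , ry) | inj₂ rz = contradiction (R-unique ry rz) y≢z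
  ... | inj₂ (_ , py) | inj₁ pz = contradiction (P-unique py pz) y≢z
  ... | inj₂ (rx , _) | inj₂ rz = contradiction (R-unique rx rz) x≢z

q-singleton : ∀ d {a n} → a ≤ n → 1 ≤ n → 1 ≤ q d a n
q-singleton d {a} a≤n 1≤n = ∈-length (∈-filter⁺ (isQDist? a d) (singleton∈partitions 1≤n) ((a≤n ∷ []) , _))

q-pair : ∀ d {a n} → 1 ≤ a → a + d + a ≤ n → 2 ≤ q d a n
q-pair d {a} {n} 1≤a a+d+a≤n =
  distinct-∈⇒2≤length (∈-filter⁺ (isQDist? a d) (singleton∈partitions 1≤n) ((a≤n ∷ []) , _))
                      (∈-filter⁺ (isQDist? a d) pair∈ ((a≤n∸a ∷ ≤-refl ∷ []) , a+d≤n∸a , _))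
                      λ ()
  where
  a+d≤n∸a : a + d ≤ n ∸ a
  a+d≤n∸a = m+n≤o⇒m≤o∸n (a + d) a+d+a≤n
  a≤n∸a : a ≤ n ∸ a
  a≤n∸a = ≤-trans (m≤m+n a d) a+d≤n∸a
  a≤n : a ≤ n
  a≤n = ≤-trans (m≤n+m a (a + d)) a+d+a≤n
  1≤n : 1 ≤ n
  1≤n = ≤-trans 1≤a a≤n
  pair∈ : (n ∸ a ∷ a ∷ []) ∈ partitions n
  pair∈ = subst (λ s → (n ∸ a ∷ a ∷ []) ∈ partitions s) (m∸n+n≡m a≤n) (pair∈partitions 1≤a a≤n∸a)

≤⌈/⌉⇒*≤ : ∀ {k m n} .{{_ : NonZero n}} → k ≤ ⌈ m / n ⌉ → k * n ≤ m + n ∸ 1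
≤⌈/⌉⇒*≤ {m = m} {n} k≤ = ≤-trans (*-monoˡ-≤ n k≤) (m/n*n≤m (m + n ∸ 1) n)

module SmallQ⁻-partitions {a d : ℕ} .{{_ : NonZero a}} (4a≤d : 4 * a ≤ d) where

  private
    m : ℕ
    m = 3 + d

  b : ℕ
  b = d + 3 + a

  a≤d : a ≤ d
  a≤d = ≤-trans (m≤n*m a 4) 4a≤d

  a<m : a < m
  a<m = ≤-trans (s≤s a≤d) (m≤n+m (suc d) 2)

  m≤b : m ≤ b
  m≤b = ≤-trans (≤-reflexive (+-comm 3 d)) (m≤m+n (d + 3) a)

  a<b : a < b
  a<b = <-≤-trans a<m m≤b

  +a<m+m : ∀ {s} → s ≤ d + 3 * a → s + a < m + m
  +a<m+m {s} s≤ = begin-strict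
    s + a          ≤⟨ +-monoˡ-≤ a s≤ ⟩
    d + 3 * a + a  ≡⟨ d+3a+a≡d+4a d a ⟩
    d + 4 * a      ≤⟨ +-monoʳ-≤ d 4a≤d ⟩
    d + d          <⟨ +-mono-< (m≤n+m (suc d) 2) (m≤n+m (suc d) 2) ⟩
    m + m          ∎
    where
    open ≤-Reasoning
    d+3a+a≡d+4a : ∀ d a → d + 3 * a + a ≡ d + 4 * a
    d+3a+a≡d+4a = solve-∀

  allowed⇒a-or-b : ∀ {p} → p ≤ d + 3 * a → AllowedPart d a p → p ≡ a ⊎ p ≡ b
  allowed⇒a-or-b {p} p≤ (residue , p≢m∸a) =
    by-residue (p % m) (p / m) (m≡m%n+[m/n]*n p m)
      (Sum.map (λ r≡ → trans r≡ (m<n⇒m%n≡m a<m)) (λ r≡ → trans r≡ (m<n⇒m%n≡m m∸a<m)) residue)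
      p≢m∸a (+a<m+m p≤)
    where
    m∸a<m : m ∸ a < m
    m∸a<m = ∸-monoʳ-< {m} {a} {0} (>-nonZero⁻¹ a) (<⇒≤ a<m)

    a+m≡b : ∀ a d → a + (3 + d + 0) ≡ d + 3 + a
    a+m≡b = solve-∀

    c+m+a≡c+a+m : ∀ c a m → c + (m + 0) + a ≡ c + a + m
    c+m+a≡c+a+m = solve-∀

    by-residue : ∀ {p} r k → p ≡ r + k * m → r ≡ a ⊎ r ≡ m ∸ a → p ≢ m ∸ a → p + a < m + m →
                 p ≡ a ⊎ p ≡ b
    by-residue r zero          refl (inj₁ refl) _ _ = inj₁ (+-identityʳ a)
    by-residue r zero          refl (inj₂ refl) p≢m∸a _ = contradiction (+-identityʳ (m ∸ a)) p≢m∸a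
    by-residue r (suc zero)    refl (inj₁ refl) _ _ = inj₂ (a+m≡b a d)
    by-residue r (suc zero)    refl (inj₂ refl) _ p+a<m+m =
      contradiction (trans (c+m+a≡c+a+m (m ∸ a) a m) (cong (_+ m) (m∸n+n≡m (<⇒≤ a<m)))) (<⇒≢ p+a<m+m)
    by-residue r (suc (suc k)) refl _ _ p+a<m+m =
      contradiction (≤-trans (+-monoʳ-≤ m (m≤m+n m (k * m))) (≤-trans (m≤n+m _ r) (m≤m+n _ a)))
                    (<⇒≱ p+a<m+m)

  IsAᵏ : List ℕ → Set
  IsAᵏ = All (_≡ a)

  IsBAᵏ : List ℕ → Set
  IsBAᵏ xs = ∃ λ t → xs ≡ b ∷ t × IsAᵏ t

  below-b⇒IsAᵏ : ∀ {t} → All (_< b) t → All (λ p → p ≡ a ⊎ p ≡ b) t → IsAᵏ t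
  below-b⇒IsAᵏ []          []               = []
  below-b⇒IsAᵏ (_ ∷ t<b)   (inj₁ refl ∷ ps) = refl ∷ below-b⇒IsAᵏ t<b ps
  below-b⇒IsAᵏ (b<b ∷ _)   (inj₂ refl ∷ _)  = contradiction b<b (<-irrefl refl)

  descending⇒shape : ∀ {xs} → AllPairs _≥_ xs → All (λ p → p ≡ a ⊎ p ≡ b) xs → sum xs ≤ d + 3 * a →
                     IsAᵏ xs ⊎ IsBAᵏ xs
  descending⇒shape [] [] _ = inj₁ []
  descending⇒shape (t≤a ∷ _) (inj₁ refl ∷ ps) _ =
    inj₁ (refl ∷ below-b⇒IsAᵏ (All.map (λ p≤a → ≤-<-trans p≤a a<b) t≤a) ps)
  descending⇒shape {_ ∷ t} _ (inj₂ refl ∷ ps) b+t≤ =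
    inj₂ (t , refl , below-b⇒IsAᵏ (All.map (λ p≤t → ≤-<-trans p≤t sum[t]<b) (parts≤sum t)) ps)
    where
    sum[t]<b : sum t < b
    sum[t]<b = ≰⇒> λ b≤t → <⇒≱ (+a<m+m b+t≤)
      (≤-trans (+-mono-≤ m≤b (≤-trans m≤b b≤t)) (m≤m+n (b + sum t) a))

  Q-list : ℕ → List (List ℕ)
  Q-list n = filter (all? (allowedPart? d a)) (partitions n)

  Q-list-shape : ∀ {n xs} → n ≤ d + 3 * a → xs ∈ Q-list n → sum xs ≡ n × (IsAᵏ xs ⊎ IsBAᵏ xs)
  Q-list-shape {n} {xs} n≤ xs∈
    with xs∈partitions , allowed ← ∈-filter⁻ (all? (allowedPart? d a)) {xs = partitions n} xs∈
    with sum≡n , xs≤n , xs↓ ← partsBounded-sound n n n xs∈partitions =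
    sum≡n ,
    descending⇒shape xs↓ (All.zipWith (λ (p≤n , p-allowed) → allowed⇒a-or-b (≤-trans p≤n n≤) p-allowed)
                                       (xs≤n , allowed))
                         (≤-trans (≤-reflexive sum≡n) n≤)

  sum-IsAᵏ : ∀ {xs} → IsAᵏ xs → sum xs ≡ length xs * a
  sum-IsAᵏ []           = refl
  sum-IsAᵏ (refl ∷ xs≡) = cong (a +_) (sum-IsAᵏ xs≡)

  IsAᵏ-unique : ∀ {xs ys} → IsAᵏ xs → IsAᵏ ys → sum xs ≡ sum ys → xs ≡ ys
  IsAᵏ-unique {xs} {ys} xs≡ ys≡ sum≡ = by-length xs≡ ys≡ (*-cancelʳ-≡ (length xs) (length ys) a
    (trans (sym (sum-IsAᵏ xs≡)) (trans sum≡ (sum-IsAᵏ ys≡))))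
    where
    by-length : ∀ {xs ys} → IsAᵏ xs → IsAᵏ ys → length xs ≡ length ys → xs ≡ ys
    by-length []           []           _   = refl
    by-length (refl ∷ xs≡) (refl ∷ ys≡) len = cong (a ∷_) (by-length xs≡ ys≡ (suc-injective len))

  IsBAᵏ-unique : ∀ {xs ys} → IsBAᵏ xs → IsBAᵏ ys → sum xs ≡ sum ys → xs ≡ ys
  IsBAᵏ-unique (t , refl , t≡) (u , refl , u≡) sum≡ =
    cong (b ∷_) (IsAᵏ-unique t≡ u≡ (+-cancelˡ-≡ b _ _ sum≡))

  IsAᵏ-IsBAᵏ⇒∣d+3 : ∀ {xs ys} → IsAᵏ xs → IsBAᵏ ys → sum xs ≡ sum ys → a ∣ d + 3
  IsAᵏ-IsBAᵏ⇒∣d+3 {xs} xs≡ (t , refl , t≡) sum≡ =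
    ∣m+n∣m⇒∣n (subst (a ∣_) (trans sum≡ (rearrange d a (sum t))) (divides (length xs) (sum-IsAᵏ xs≡)))
              (divides (suc (length t)) (cong (a +_) (sum-IsAᵏ t≡)))
    where
    rearrange : ∀ d a s → d + 3 + a + s ≡ a + s + (d + 3)
    rearrange = solve-∀

  shape⇒a≤sum : ∀ {xs} → 1 ≤ sum xs → IsAᵏ xs ⊎ IsBAᵏ xs → a ≤ sum xs
  shape⇒a≤sum {[]}    ()
  shape⇒a≤sum {_ ∷ t} _ (inj₁ (refl ∷ _))    = m≤m+n a (sum t)
  shape⇒a≤sum         _ (inj₂ (t , refl , _)) = ≤-trans (<⇒≤ a<b) (m≤m+n b (sum t))

  Q⁻≤q : ∀ {n} → 1 ≤ n → n ≤ d + 3 * a →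
         (∀ {xs ys} → IsAᵏ xs → IsBAᵏ ys → sum xs ≡ n → sum ys ≡ n → 2 ≤ q d a n) →
         Q⁻ d a n ≤ q d a n
  Q⁻≤q {n} 1≤n n≤ mixed =
    length≤-of-two-classes
      (λ (xs≡ , sum≡n) (ys≡ , sum≡n′) → IsAᵏ-unique xs≡ ys≡ (trans sum≡n (sym sum≡n′)))
      (λ (xs≡ , sum≡n) (ys≡ , sum≡n′) → IsBAᵏ-unique xs≡ ys≡ (trans sum≡n (sym sum≡n′)))
      (Q-list n) (Unique.filter⁺ (all? (allowedPart? d a)) (partsBounded-unique n n n))
      class nonempty (λ _ _ (xs≡ , sum≡n) (ys≡ , sum≡n′) → mixed xs≡ ys≡ sum≡n sum≡n′)
    where
    class : ∀ {xs} → xs ∈ Q-list n → (IsAᵏ xs × sum xs ≡ n) ⊎ (IsBAᵏ xs × sum xs ≡ n)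
    class xs∈ with sum≡n , shape ← Q-list-shape n≤ xs∈ = Sum.map (_, sum≡n) (_, sum≡n) shape

    nonempty : ∀ {xs} → xs ∈ Q-list n → 1 ≤ q d a n
    nonempty xs∈ with sum≡n , shape ← Q-list-shape n≤ xs∈ =
      q-singleton d (subst (a ≤_) sum≡n (shape⇒a≤sum (subst (1 ≤_) (sym sum≡n) 1≤n) shape)) 1≤n

  Q⁻≤q-if-∤ : ¬ (a ∣ d + 3) → ∀ {n} → 1 ≤ n → n ≤ d + 3 * a → Q⁻ d a n ≤ q d a n
  Q⁻≤q-if-∤ a∤d+3 1≤n n≤ = Q⁻≤q 1≤n n≤ λ xs≡ ys≡ sum≡n sum≡n′ →
    contradiction (IsAᵏ-IsBAᵏ⇒∣d+3 xs≡ ys≡ (trans sum≡n (sym sum≡n′))) a∤d+3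

  Q⁻≤q-if-≢b : ∀ {n} → 1 ≤ n → n ≤ d + 3 * a → n ≢ b → Q⁻ d a n ≤ q d a n
  Q⁻≤q-if-≢b {n} 1≤n n≤ n≢b = Q⁻≤q 1≤n n≤ mixed
    where
    a+d≤b : a + d ≤ b
    a+d≤b = ≤-trans (≤-reflexive (+-comm a d)) (+-monoˡ-≤ a (m≤m+n d 3))

    mixed : ∀ {xs ys} → IsAᵏ xs → IsBAᵏ ys → sum xs ≡ n → sum ys ≡ n → 2 ≤ q d a n
    mixed _ ([] , refl , []) _ sum≡n = contradiction (trans (sym sum≡n) (+-identityʳ b)) n≢b
    mixed _ (_ ∷ t , refl , refl ∷ _) _ sum≡n = q-pair d (>-nonZero⁻¹ a) (begin
      a + d + a        ≤⟨ +-monoˡ-≤ a a+d≤b ⟩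
      b + a            ≤⟨ +-monoʳ-≤ b (m≤m+n a (sum t)) ⟩
      b + (a + sum t)  ≡⟨ sum≡n ⟩
      n                ∎)
      where open ≤-Reasoning

lemma6p1 : (a d : ℕ) → .{{_ : NonZero a}} → 1 ≤ a → 1 ≤ d → a ≤ d + 2 → 12 ≤ ⌈ d / a ⌉ →
    ((¬ (a ∣ d + 3)) → (n : ℕ) → 1 ≤ n → n ≤ d + 3 * a → Q⁻ d a n ≤ q d a n)
    × ((a ∣ d + 3) → (n : ℕ) → 1 ≤ n → n ≤ d + 3 * a → n ≢ d + 3 + a → Q⁻ d a n ≤ q d a n)
lemma6p1 a d _ _ _ 12≤⌈d/a⌉ =
  (λ a∤d+3 _ → Q⁻≤q-if-∤ a∤d+3) , (λ _ _ → Q⁻≤q-if-≢b)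
  where
  11a≤d : 11 * a ≤ d
  11a≤d = +-cancelˡ-≤ a (11 * a) d (begin
    12 * a        ≤⟨ ≤⌈/⌉⇒*≤ {m = d} 12≤⌈d/a⌉ ⟩
    d + a ∸ 1     ≤⟨ m∸n≤m (d + a) 1 ⟩
    d + a         ≡⟨ +-comm d a ⟩
    a + d         ∎)
    where open ≤-Reasoning

  open SmallQ⁻-partitions (≤-trans (*-monoˡ-≤ a (m≤m+n 4 7)) 11a≤d)
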